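{- Let $\mathcal{F}:\mathbb{F}_{q^t}^r\to\mathbb{F}_q^{rt}$ be a vfr-map. Let $\pi,\pi'$ be $(n-1)$-dimensional subspaces of $\mathrm{PG}(rt-1,q)$ intersecting in a point $P=\langle\mathcal{F}(v)\rangle_q$ such that $\pi\cap\{\langle\mathcal{F}(\alpha v)\rangle_q\mid\alpha\in\mathbb{F}_{q^t}^*\}=\pi'\cap\{\langle\mathcal{F}(\alpha v)\rangle_q\mid\alpha\in\mathbb{F}_{q^t}^*\}=\{P\}$. Suppose $\mathcal{B}(\pi)=\mathcal{B}(\pi')$ and that Condition (B) holds for $(L,n)$ with $L=\mathcal{B}(\pi)$. Then $\pi=\pi'$.
   Context: A vfr-map $\mathcal{F}:\mathbb{F}_{q^t}^r\to\mathbb{F}_q^{rt}$ is an $\mathbb{F}_q$-linear bijection (e.g. obtained by fixing an $\mathbb{F}_q$-basis of $\mathbb{F}_{q^t}$ and taking coordinates). Points of $\mathrm{PG}(rt-1,q)$ are $\langle w\rangle_q$, points of $\mathrm{PG}(r-1,q^t)$ are $\langle v\rangle_{q^t}$; for a subspace $U$ of $\mathbb{F}_q^{rt}$, $\langle U\rangle_q$ is the projective subspace it determines. For an $\mathbb{F}_q$-subspace $U$, $\mathcal{B}(U)=\{\langle v\rangle_{q^t}\mid v\in\mathcal{F}^{ -1}(U\setminus\{0\})\}$ and $\mathcal{B}(\langle U\rangle_q)=\mathcal{B}(U)$. For $\beta\in\mathbb{F}_{q^t}^*$, $m_\beta:v\mapsto\beta v$ on $\mathbb{F}_{q^t}^r$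 and $\mathcal{F}(m_\beta)$ is the map on $\mathbb{F}_q^{rt}$ with $\mathcal{F}(m_\beta)(\mathcal{F}(v))=\mathcal{F}(\beta v)$. Condition (B) for $(L,n)$: whenever $U,U'$ are $n$-dimensional $\mathbb{F}_q$-subspaces of $\mathbb{F}_q^{rt}$ with $\mathcal{B}(U)=L=\mathcal{B}(U')$, then $U'=\mathcal{F}(m_\beta)(U)$ for some $\beta\in\mathbb{F}_{q^t}^*$. -}

module Defs where

open import Level using (0ℓ)
open import Data.Nat using (ℕ; _*_)
open import Data.Vec using (Vec; []; _∷_; zipWith; map; replicate)
open import Data.Product using (Σ; ∃; _×_; _,_)
open import Algebra.Core using (Op₁; Op₂)
open import Algebra.Structures using (IsCommutativeRing)
open import Function.Bundles using (_⇔_)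
open import Function.Definitions using (Bijective)
open import Relation.Binary.PropositionalEquality using (_≡_; _≢_)

record Field : Set₁ where
  field
    Carrier : Set
    _+_ _·_ : Op₂ Carrier
    -_ : Op₁ Carrier
    0# 1# : Carrier
    isCommutativeRing : IsCommutativeRing _≡_ _+_ _·_ -_ 0# 1#
    0≢1 : 0# ≢ 1#
    inverse : ∀ x → x ≢ 0# → Σ Carrier λ y → x · y ≡ 1#

open Field public using (Carrier)

record FieldHom (k K : Field) : Set where
  private
    module k = Field k
    module K = Field K
  field
    ι : k.Carrier → K.Carrier
    ι-+ : ∀ a b → ι (a k.+ b) ≡ ι a K.+ ι b
    ι-· : ∀ a b → ι (a k.· b) ≡ ι a K.· ι b
    ι-1 : ι k.1# ≡ K.1#

open FieldHom public using (ι)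

module _ (k : Field) where
  private module k = Field k

  vadd : ∀ {m} → Vec k.Carrier m → Vec k.Carrier m → Vec k.Carrier m
  vadd = zipWith k._+_

  smul : ∀ {m} → k.Carrier → Vec k.Carrier m → Vec k.Carrier m
  smul c = map (c k.·_)

  zeroV : ∀ {m} → Vec k.Carrier m
  zeroV = replicate _ k.0#

  lincomb : ∀ {m n} → Vec k.Carrier n → Vec (Vec k.Carrier m) n → Vec k.Carrier m
  lincomb [] [] = zeroV
  lincomb (c ∷ cs) (b ∷ bs) = vadd (smul c b) (lincomb cs bs)

  LinIndep : ∀ {m n} → Vec (Vec k.Carrier m) n → Set
  LinIndep b = ∀ c → lincomb c b ≡ zeroV → c ≡ zeroV

  HasDim : ∀ {m} → (Vec k.Carrier m → Set) → ℕ → Set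
  HasDim {m} U n = Σ (Vec (Vec k.Carrier m) n) λ b →
    LinIndep b × (∀ w → U w ⇔ (Σ (Vec k.Carrier n) λ c → w ≡ lincomb c b))

record VfrMap (k K : Field) (φ : FieldHom k K) (r t : ℕ) : Set where
  field
    F : Vec (Carrier K) r → Vec (Carrier k) (r * t)
    F-add : ∀ x y → F (vadd K x y) ≡ vadd k (F x) (F y)
    F-smul : ∀ c x → F (smul K (ι φ c) x) ≡ smul k c (F x)
    F-bij : Bijective _≡_ _≡_ F

open VfrMap public using (F)

module _ {k K : Field} {φ : FieldHom k K} {r t : ℕ} (𝓕 : VfrMap k K φ r t) where
  private
    module k = Field k
    module K = Field K

  Subsp : Set₁
  Subsp = Vec k.Carrier (r * t) → Set

  SameKPoint : Vec K.Carrier r → Vec K.Carrier r → Set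
  SameKPoint x y = Σ K.Carrier λ β → β ≢ K.0# × y ≡ smul K β x

  InB : Subsp → Vec K.Carrier r → Set
  InB U x = Σ (Vec K.Carrier r) λ y → y ≢ zeroV K × U (F 𝓕 y) × SameKPoint y x

  SameB : Subsp → Subsp → Set
  SameB U U' = ∀ x → InB U x ⇔ InB U' x

  ImageMβ : K.Carrier → Subsp → Subsp
  ImageMβ β U w = Σ (Vec K.Carrier r) λ y → U (F 𝓕 y) × w ≡ F 𝓕 (smul K β y)

  -- Condition (B) for (L, n), L a set of points given by representatives
  ConditionB : (Vec K.Carrier r → Set) → ℕ → Set₁
  ConditionB L n = ∀ (U₁ U₂ : Subsp) → HasDim k U₁ n → HasDim k U₂ n →
    (∀ x → InB U₁ x ⇔ L x) → (∀ x → InB U₂ x ⇔ L x) →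
    Σ K.Carrier λ β → β ≢ K.0# × (∀ w → U₂ w ⇔ ImageMβ β U₁ w)

  MeetInPoint : Subsp → Subsp → Vec K.Carrier r → Set
  MeetInPoint U U' v = v ≢ zeroV K ×
    (∀ w → (U w × U' w) ⇔ (Σ k.Carrier λ c → w ≡ smul k c (F 𝓕 v)))

  OrbitMeet : Subsp → Vec K.Carrier r → Set
  OrbitMeet U v = U (F 𝓕 v) ×
    (∀ α → α ≢ K.0# → U (F 𝓕 (smul K α v)) →
      Σ k.Carrier λ c → c ≢ k.0# × F 𝓕 (smul K α v) ≡ smul k c (F 𝓕 v))

-- Condition (B) gives β with π' = F(m_β)(π). Since P ∈ π', the point ⟨F(β⁻¹v)⟩_q lies in π,
-- and it lies on the orbit of P, so the orbit hypothesis gives F(β⁻¹v) = c·F(v) with c ∈ F_q*.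
-- Injectivity of F and v ≠ 0 force cβ = 1, so β = c⁻¹ ∈ F_q*; but multiplication by a
-- nonzero scalar of F_q fixes every F_q-subspace, hence π' = π.
module Submission where

open import Defs
open import Data.Nat using (ℕ; _^_)
open import Data.Fin using (Fin)
import Data.Fin.Properties as Fin
open import Data.Vec using (Vec; []; _∷_; head; tail; replicate)
open import Data.Vec.Properties using (map-∘; map-cong; map-id; map-replicate)
open import Data.Product using (Σ; _×_; _,_; proj₁; proj₂)
open import Data.Empty using (⊥-elim)
open import Function.Bundles using (_↔_; _⇔_; mk⇔; module Equivalence)
open import Function.Properties.Inverse using (↔⇒↣)
import Function.Properties.Equivalence as ⇔
open import Algebra.Structures using (IsCommutativeRing)
open import Relation.Binary.Definitions using (DecidableEquality)
open import Relation.Binary.PropositionalEquality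
open import Relation.Nullary using (yes; no)
open import Relation.Nullary.Decidable using (via-injection)

finite⇒decidableEquality : ∀ {A : Set} {m} → A ↔ Fin m → DecidableEquality A
finite⇒decidableEquality A↔Fin = via-injection (↔⇒↣ A↔Fin) Fin._≟_

module VectorSpace (K : Field) where
  open Field K hiding (Carrier)
  open IsCommutativeRing isCommutativeRing
    using (*-assoc; *-comm; *-identityˡ; *-identityʳ; distribˡ; zeroʳ)
  open ≡-Reasoning

  private
    C = Carrier K

  ·-inverse-unique : ∀ a b c → a · b ≡ 1# → a · c ≡ 1# → b ≡ c
  ·-inverse-unique a b c ab≡1 ac≡1 = begin
    b             ≡⟨ sym (*-identityˡ b) ⟩
    1# · b        ≡⟨ cong (_· b) (trans (sym ac≡1) (*-comm a c)) ⟩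
    (c · a) · b   ≡⟨ *-assoc c a b ⟩
    c · (a · b)   ≡⟨ cong (c ·_) ab≡1 ⟩
    c · 1#        ≡⟨ *-identityʳ c ⟩
    c             ∎

  ·≡1#⇒≢0# : ∀ a b → a · b ≡ 1# → b ≢ 0#
  ·≡1#⇒≢0# a b ab≡1 refl = 0≢1 (trans (sym (zeroʳ a)) ab≡1)

  smul-assoc : ∀ {m} a b (y : Vec C m) → smul K a (smul K b y) ≡ smul K (a · b) y
  smul-assoc a b y = trans (sym (map-∘ _ _ y)) (map-cong (λ x → sym (*-assoc a b x)) y)

  smul-identityˡ : ∀ {m} (y : Vec C m) → smul K 1# y ≡ y
  smul-identityˡ y = trans (map-cong *-identityˡ y) (map-id y)

  smul-zeroʳ : ∀ {m} a → smul K a (zeroV K {m}) ≡ zeroV K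
  smul-zeroʳ {m} a = trans (map-replicate (a ·_) 0# m) (cong (replicate m) (zeroʳ a))

  smul-distribˡ-vadd : ∀ {m} a (x y : Vec C m) →
    smul K a (vadd K x y) ≡ vadd K (smul K a x) (smul K a y)
  smul-distribˡ-vadd a []       []       = refl
  smul-distribˡ-vadd a (x ∷ xs) (y ∷ ys) = cong₂ _∷_ (distribˡ a x y) (smul-distribˡ-vadd a xs ys)

  smul-lincomb : ∀ {m n} a (cs : Vec C n) (bs : Vec (Vec C m) n) →
    smul K a (lincomb K cs bs) ≡ lincomb K (smul K a cs) bs
  smul-lincomb a []       []       = smul-zeroʳ a
  smul-lincomb a (c ∷ cs) (b ∷ bs) = begin
    smul K a (vadd K (smul K c b) (lincomb K cs bs))
      ≡⟨ smul-distribˡ-vadd a (smul K c b) (lincomb K cs bs) ⟩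
    vadd K (smul K a (smul K c b)) (smul K a (lincomb K cs bs))
      ≡⟨ cong₂ (vadd K) (smul-assoc a c b) (smul-lincomb a cs bs) ⟩
    vadd K (smul K (a · c) b) (lincomb K (smul K a cs) bs) ∎

  HasDim⇒smul-closed : ∀ {m n} {U : Vec C m → Set} → HasDim K U n →
    ∀ a {w} → U w → U (smul K a w)
  HasDim⇒smul-closed {U = U} (b , _ , U⇔span) a {w} Uw with Equivalence.to (U⇔span w) Uw
  ... | cs , refl = Equivalence.from (U⇔span _) (smul K a cs , smul-lincomb a cs b)

  smul-cancelˡ : ∀ {m} {β β⁻¹} {v y : Vec C m} → β · β⁻¹ ≡ 1# → v ≡ smul K β y → smul K β⁻¹ v ≡ y
  smul-cancelˡ {β = β} {β⁻¹} {y = y} ββ⁻¹≡1 refl = begin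
    smul K β⁻¹ (smul K β y)   ≡⟨ smul-assoc β⁻¹ β y ⟩
    smul K (β⁻¹ · β) y        ≡⟨ cong (λ a → smul K a y) (trans (*-comm β⁻¹ β) ββ⁻¹≡1) ⟩
    smul K 1# y               ≡⟨ smul-identityˡ y ⟩
    y                         ∎

  -- A nonzero vector has a nonzero coordinate x, and γ·x = x then gives γ = 1.
  smul-fixed⇒≡1# : DecidableEquality C → ∀ {m} γ (y : Vec C m) →
    smul K γ y ≡ y → y ≢ zeroV K → γ ≡ 1#
  smul-fixed⇒≡1# _≟_ γ []      _     y≢0 = ⊥-elim (y≢0 refl)
  smul-fixed⇒≡1# _≟_ γ (x ∷ y) γy≡y y≢0 with x ≟ 0# | inverse x
  ... | yes refl | _   = smul-fixed⇒≡1# _≟_ γ y (cong tail γy≡y) (λ y≡0 → y≢0 (cong (0# ∷_) y≡0))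
  ... | no x≢0   | inv with inv x≢0
  ...   | u , xu≡1 = begin
    γ             ≡⟨ sym (*-identityʳ γ) ⟩
    γ · 1#        ≡⟨ cong (γ ·_) (sym xu≡1) ⟩
    γ · (x · u)   ≡⟨ sym (*-assoc γ x u) ⟩
    (γ · x) · u   ≡⟨ cong (_· u) (cong head γy≡y) ⟩
    x · u         ≡⟨ xu≡1 ⟩
    1#            ∎

module _ {k K : Field} {φ : FieldHom k K} {r t : ℕ} (𝓕 : VfrMap k K φ r t) where
  private
    module k = Field k
    module K = Field K
    module Vk = VectorSpace k
    module VK = VectorSpace K
    module φ = FieldHom φ
    module 𝓕 = VfrMap 𝓕

  F-injective : ∀ {x y} → F 𝓕 x ≡ F 𝓕 y → x ≡ y
  F-injective = proj₁ 𝓕.F-bij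

  ι-inverse : ∀ {c d} → c k.· d ≡ k.1# → ι φ c K.· ι φ d ≡ K.1#
  ι-inverse {c} {d} cd≡1 = trans (sym (φ.ι-· c d)) (trans (cong (ι φ) cd≡1) φ.ι-1)

  ImageMβ-ι : ∀ {n d} {U : Subsp 𝓕} → HasDim k U n → d ≢ k.0# →
    ∀ w → ImageMβ 𝓕 (ι φ d) U w ⇔ U w
  ImageMβ-ι {d = d} {U} dimU d≢0 w = mk⇔ to from
    where
      d⁻¹ = proj₁ (k.inverse d d≢0)
      dd⁻¹≡1 = proj₂ (k.inverse d d≢0)

      to : ImageMβ 𝓕 (ι φ d) U w → U w
      to (y , Uy , refl) = subst U (sym (𝓕.F-smul d y)) (Vk.HasDim⇒smul-closed dimU d Uy)

      from : U w → ImageMβ 𝓕 (ι φ d) U w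
      from Uw = y , Uy , sym (begin
          F 𝓕 (smul K (ι φ d) (smul K (ι φ d⁻¹) z))  ≡⟨ cong (F 𝓕) (VK.smul-assoc (ι φ d) (ι φ d⁻¹) z) ⟩
          F 𝓕 (smul K (ι φ d K.· ι φ d⁻¹) z)         ≡⟨ cong (λ a → F 𝓕 (smul K a z)) (ι-inverse dd⁻¹≡1) ⟩
          F 𝓕 (smul K K.1# z)                         ≡⟨ cong (F 𝓕) (VK.smul-identityˡ z) ⟩
          F 𝓕 z                                       ≡⟨ Fz≡w ⟩
          w                                           ∎)
        where
          open ≡-Reasoning
          z = proj₁ (proj₂ 𝓕.F-bij w)
          Fz≡w : F 𝓕 z ≡ w
          Fz≡w = proj₂ (proj₂ 𝓕.F-bij w) refl
          y = smul K (ι φ d⁻¹) z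
          Uy : U (F 𝓕 y)
          Uy = subst U (sym (𝓕.F-smul d⁻¹ z))
                 (Vk.HasDim⇒smul-closed dimU d⁻¹ (subst U (sym Fz≡w) Uw))

  ImageMβ∋Fv⇒β∈ι[k] : DecidableEquality (Carrier K) → ∀ {U : Subsp 𝓕} {v β} →
    v ≢ zeroV K → OrbitMeet 𝓕 U v → β ≢ K.0# → ImageMβ 𝓕 β U (F 𝓕 v) →
    Σ k.Carrier λ d → d ≢ k.0# × β ≡ ι φ d
  ImageMβ∋Fv⇒β∈ι[k] _≟_ {U} {v} {β} v≢0 (_ , orbit) β≢0 (y , Uy , Fv≡Fβy)
    with K.inverse β β≢0
  ... | β⁻¹ , ββ⁻¹≡1
    with orbit β⁻¹ (VK.·≡1#⇒≢0# β β⁻¹ ββ⁻¹≡1)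
               (subst U (cong (F 𝓕) (sym (VK.smul-cancelˡ ββ⁻¹≡1 (F-injective Fv≡Fβy)))) Uy)
  ... | c , c≢0 , Fβ⁻¹v≡cFv
    with k.inverse c c≢0
  ... | d , cd≡1 =
    d , Vk.·≡1#⇒≢0# c d cd≡1 , VK.·-inverse-unique (ι φ c) β (ι φ d) cβ≡1 (ι-inverse cd≡1)
    where
      open ≡-Reasoning
      v≡βy = F-injective Fv≡Fβy

      y≢0 : y ≢ zeroV K
      y≢0 y≡0 = v≢0 (trans v≡βy (trans (cong (smul K β) y≡0) (VK.smul-zeroʳ β)))

      cβy≡y : smul K (ι φ c K.· β) y ≡ y
      cβy≡y = F-injective (begin
        F 𝓕 (smul K (ι φ c K.· β) y)        ≡⟨ cong (F 𝓕) (sym (VK.smul-assoc (ι φ c) β y)) ⟩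
        F 𝓕 (smul K (ι φ c) (smul K β y))   ≡⟨ cong (λ x → F 𝓕 (smul K (ι φ c) x)) (sym v≡βy) ⟩
        F 𝓕 (smul K (ι φ c) v)              ≡⟨ 𝓕.F-smul c v ⟩
        smul k c (F 𝓕 v)                    ≡⟨ sym Fβ⁻¹v≡cFv ⟩
        F 𝓕 (smul K β⁻¹ v)                  ≡⟨ cong (F 𝓕) (VK.smul-cancelˡ ββ⁻¹≡1 v≡βy) ⟩
        F 𝓕 y                               ∎)

      cβ≡1 : ι φ c K.· β ≡ K.1#
      cβ≡1 = VK.smul-fixed⇒≡1# _≟_ _ y cβy≡y y≢0

theorem6p5 : (q t r n : ℕ) (k K : Field) → Carrier k ↔ Fin q → Carrier K ↔ Fin (q ^ t) →
    (φ : FieldHom k K) (𝓕 : VfrMap k K φ r t) →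
    (U U' : Subsp 𝓕) → HasDim k U n → HasDim k U' n →
    (v : _) → MeetInPoint 𝓕 U U' v → OrbitMeet 𝓕 U v → OrbitMeet 𝓕 U' v →
    SameB 𝓕 U U' → ConditionB 𝓕 (InB 𝓕 U) n →
    ∀ w → U w ⇔ U' w
theorem6p5 q t r n k K _ K↔Fin φ 𝓕 U U' dimU dimU' v (v≢0 , _) orbitU (U'Fv , _) sameB condB
  with condB U U' dimU dimU' (λ _ → ⇔.refl) (λ x → ⇔.sym (sameB x))
... | β , β≢0 , U'⇔βU
  with ImageMβ∋Fv⇒β∈ι[k] 𝓕 (finite⇒decidableEquality K↔Fin) {U} v≢0 orbitU β≢0
         (Equivalence.to (U'⇔βU (F 𝓕 v)) U'Fv)
... | d , d≢0 , refl = λ w → ⇔.sym (⇔.trans (U'⇔βU w) (ImageMβ-ι 𝓕 dimU d≢0 w))
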